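{- For every $\pi\in S_n$, the pre-order $\mu(\pi)$ equals the pre-order $P(\Gamma_\pi)$ on $[n]$ defined by $i\preceq j$ if and only if $x_i\le x_j$ for all $x\in\Gamma_\pi$, where $\Gamma_\pi$ is the shard intersection corresponding to $\pi$ (the intersection of the lower shards of the region $R_\pi$ of the braid arrangement).
   Context: Braid arrangement in $\mathbb{R}^n$: hyperplanes $H_{ij}=\{x_i=x_j\}$, $i<j$; regions $R_\pi=\{x: x_{\pi_1}\le\cdots\le x_{\pi_n}\}$; base region $R_{12\cdots n}$; poset of regions ordered by inclusion of separating sets of hyperplanes from the base region. The shards in $H_{ij}$ are the cones $\{x: x_i=x_j,\ \epsilon_kx_i\le\epsilon_kx_k \text{ for } i<k<j\}$, $\epsilon_k\in\{\pm1\}$. A lower shard of a region $R$ is a shard containing a facet of $R$ whose hyperplane separates $R$ from a region covered by $R$ in the poset of regions. $\Gamma_\pi$ is the intersection of the lower shards of $R_\pi$ ($\mathbb{R}^n$ if there are none). A pre-order on $[n]$ is a reflexive transitive relation $\preceq$; its blocks are the classes of $i\equiv j \iff i\preceq j\preceq i$, and $\preceq$ induces a partial order on blocks. A descending run of $\pi=\pi_1\cdots\pi_n$ is a maximal consecutive decreasing sequence of entries. The map $\mu$: for $\pi\in S_n$, $\mu(\pi)$ is the pre-order whose blocks are the sets of entries of the descending runs of $\pi$, where for two distinct descending runs $D,E$ whose intervals $[\min D,\max D]$ and $[\min E,\max E]$ intersect, we set block $D\preceq$ block $E$ iff $D$ occurs to the left of $E$ in $\pi$; $\mu(\pi)$ is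 the transitive (and reflexive) closure of these relations.
   Formalization: The regions $R_\pi$, the shards, $\Gamma_\pi$ and the points x defining $P(\Gamma_\pi)$ are taken in ℚ^n rather than ℝ^n. -}

module Defs where

open import Data.Nat using (ℕ; suc) renaming (_≤_ to _≤ℕ_; _<_ to _<ℕ_)
open import Data.Fin using (Fin; toℕ)
open import Data.Fin.Permutation using (Permutation′; _⟨$⟩ʳ_; _⟨$⟩ˡ_)
open import Data.Bool using (Bool; true; false)
open import Data.Rational using (ℚ) renaming (_≤_ to _≤ℚ_)
open import Data.Product using (Σ; ∃; _×_; _,_)
open import Data.Sum using (_⊎_)
open import Relation.Nullary using (¬_)
open import Relation.Binary.PropositionalEquality using (_≡_)
open import Relation.Binary.Construct.Closure.ReflexiveTransitive using (Star)

-- A permutation π ∈ S_n in one-line notation: π_p = π ⟨$⟩ʳ p (positions p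
-- and entries are both Fin n, i.e. [n] is encoded as {0,…,n-1}).
-- The position of entry a in π is π ⟨$⟩ˡ a.

entry : ∀ {n} → Permutation′ n → Fin n → Fin n
entry π p = π ⟨$⟩ʳ p

pos : ∀ {n} → Permutation′ n → Fin n → Fin n
pos π a = π ⟨$⟩ˡ a

-- positions p ≤ q lie in the same descending run: every consecutive pair of
-- positions r, r+1 with p ≤ r < q is a descent π_r > π_{r+1}
DescBetween : ∀ {n} → Permutation′ n → Fin n → Fin n → Set
DescBetween {n} π p q =
  toℕ p ≤ℕ toℕ q ×
  (∀ (r s : Fin n) → toℕ p ≤ℕ toℕ r → suc (toℕ r) ≡ toℕ s → toℕ s ≤ℕ toℕ q →
     toℕ (entry π s) <ℕ toℕ (entry π r))

SameRun : ∀ {n} → Permutation′ n → Fin n → Fin n → Set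
SameRun π a b = DescBetween π (pos π a) (pos π b) ⊎ DescBetween π (pos π b) (pos π a)

-- the intervals [min D, max D] and [min E, max E] of the runs D ∋ a and E ∋ b
-- intersect, i.e. min D ≤ max E and min E ≤ max D
RunIntervalsMeet : ∀ {n} → Permutation′ n → Fin n → Fin n → Set
RunIntervalsMeet {n} π a b =
  (∃ λ (d : Fin n) → ∃ λ (e : Fin n) →
     SameRun π a d × SameRun π b e × toℕ d ≤ℕ toℕ e) ×
  (∃ λ (d : Fin n) → ∃ λ (e : Fin n) →
     SameRun π a d × SameRun π b e × toℕ e ≤ℕ toℕ d)

-- generating relations of μ(π), on entries: a and b in the same run, or
-- a in run D, b in a different run E, the intervals of D and E meet and
-- D occurs to the left of E
μStep : ∀ {n} → Permutation′ n → Fin n → Fin n → Set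
μStep π a b =
  SameRun π a b ⊎
  (¬ SameRun π a b × RunIntervalsMeet π a b × toℕ (pos π a) <ℕ toℕ (pos π b))

μ : ∀ {n} → Permutation′ n → Fin n → Fin n → Set
μ π = Star (μStep π)

Point : ℕ → Set
Point n = Fin n → ℚ

Region : ∀ {n} → Permutation′ n → Point n → Set
Region {n} π x = ∀ (p q : Fin n) → suc (toℕ p) ≡ toℕ q →
  x (entry π p) ≤ℚ x (entry π q)

Hyp : ∀ {n} → Fin n → Fin n → Point n → Set
Hyp i j x = x i ≡ x j

-- separating set S(R_π) of hyperplanes H_ij (i<j) between R_π and the base
-- region R_{12⋯n}: exactly the inversions of π
Sep : ∀ {n} → Permutation′ n → Fin n → Fin n → Set
Sep π i j = toℕ i <ℕ toℕ j × toℕ (pos π j) <ℕ toℕ (pos π i)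

_≤R_ : ∀ {n} → Permutation′ n → Permutation′ n → Set
σ ≤R π = ∀ i j → Sep σ i j → Sep π i j

_<R_ : ∀ {n} → Permutation′ n → Permutation′ n → Set
σ <R π = σ ≤R π × ¬ (π ≤R σ)

_⋖R_ : ∀ {n} → Permutation′ n → Permutation′ n → Set
_⋖R_ {n} σ π = σ <R π × (∀ (τ : Permutation′ n) → ¬ (σ <R τ × τ <R π))

Separates : ∀ {n} → Fin n → Fin n → Permutation′ n → Permutation′ n → Set
Separates i j π σ = (Sep π i j × ¬ Sep σ i j) ⊎ (Sep σ i j × ¬ Sep π i j)

-- shard in H_ij with signs ε (ε k = true means ε_k = +1):
-- {x : x_i = x_j, ε_k x_i ≤ ε_k x_k for i<k<j}
Shard : ∀ {n} → Fin n → Fin n → (Fin n → Bool) → Point n → Set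
Shard {n} i j ε x = Hyp i j x ×
  (∀ (k : Fin n) → toℕ i <ℕ toℕ k → toℕ k <ℕ toℕ j →
     (ε k ≡ true → x i ≤ℚ x k) × (ε k ≡ false → x k ≤ℚ x i))

-- the shard (i,j,ε) (i<j) is a lower shard of R_π: its hyperplane H_ij
-- separates R_π from a region R_σ covered by R_π, and it contains the facet
-- R_π ∩ H_ij of R_π
LowerShard : ∀ {n} → Permutation′ n → Fin n → Fin n → (Fin n → Bool) → Set
LowerShard {n} π i j ε =
  toℕ i <ℕ toℕ j ×
  (∃ λ (σ : Permutation′ n) → σ ⋖R π × Separates i j π σ) ×
  (∀ (x : Point n) → Region π x → Hyp i j x → Shard i j ε x)

-- Γ_π: intersection of the lower shards of R_π (all of ℚ^n if none)
Γ : ∀ {n} → Permutation′ n → Point n → Set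
Γ {n} π x = ∀ (i j : Fin n) (ε : Fin n → Bool) → LowerShard π i j ε → Shard i j ε x

P : ∀ {n} → (Point n → Set) → Fin n → Fin n → Set
P {n} C i j = ∀ (x : Point n) → C x → x i ≤ℚ x j

-- Every lower shard of R_π is the shard of a descent π_r > π_s (s = r + 1) of π: it lies in
-- H_{π_s π_r}, the region it separates R_π from is R_π with that descent swapped, and
-- evaluating its facet condition at 0/1 points of R_π forces ε_k = +1 exactly for the
-- entries k to the right of the descent.  So x ∈ Γ_π iff x is constant on descending runs
-- and, for every descent and every value k strictly between its two entries, x_k lies
-- above (resp. below) the common value of the run when k is to the right (resp. left).
-- If a run D lies left of a run E and their value intervals meet, some entry of one lies
-- strictly between the entries of a descent of the other, which gives x_D ≤ x_E; hence
-- μ(π) ⊆ P(Γ_π).  Conversely, the entries reachable from i along runs and along such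
-- overlapping runs form a set whose indicator function satisfies all these constraints;
-- it is a point of Γ_π equal to 1 at i, so P(Γ_π) ⊆ μ(π).

module Submission where

open import Defs
open import Data.Nat using (ℕ; zero; suc; _≤_; _<_; _≤?_; _<?_; s≤s)
import Data.Nat.Properties as ℕ
open import Data.Fin using (Fin; toℕ; fromℕ<) renaming (_<_ to _<ᶠ_)
open import Data.Fin.Permutation using (Permutation′; inverseˡ; inverseʳ; transpose; _∘ₚ_) renaming (flip to inverse)
open import Function.Bundles using (Injection)
open import Relation.Binary.Construct.Closure.ReflexiveTransitive using (fold; return; _◅◅_)
open import Function.Properties.Inverse using (↔⇒↣)
open import Data.Fin.Properties using (toℕ-injective; toℕ<n; toℕ-fromℕ<; all?; any?) renaming (_≟_ to _≟ᶠ_)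
open import Data.Product using (∃; ∃₂; _×_; _,_; proj₁; proj₂)
open import Data.Sum using (_⊎_; inj₁; inj₂; [_,_]′)
open import Relation.Binary.Core using (Rel)
open import Relation.Binary.Definitions using (Reflexive; Transitive; tri<; tri≈; tri>)
open import Relation.Nullary using (¬_; Dec; yes; no; does; contradiction)
open import Relation.Nullary.Decidable using (dec-true; dec-false; map′; ¬?; _×-dec_; _⊎-dec_; _→-dec_; toWitness; toWitnessFalse)
open import Relation.Unary using (Pred)
open import Function using (id; _∘_; flip)
import Data.Fin.Permutation.Components as PC
open import Data.Rational using (ℚ; 0ℚ; 1ℚ) renaming (_≤_ to _≤ℚ_; _≤?_ to _≤ℚ?_)
import Data.Rational.Properties as ℚ
open import Data.Unit using (tt)
open import Data.Bool using (Bool; true; false)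
open import Relation.Binary.PropositionalEquality using (_≡_; _≢_; refl; sym; trans; cong; subst; subst₂; module ≡-Reasoning)

private
  variable
    n : ℕ

adjacent-chain : ∀ {a ℓ} {A : Set a} (_∼_ : Rel A ℓ) → Reflexive _∼_ → Transitive _∼_ →
  (f : Fin n → A) {p q : Fin n} → toℕ p ≤ toℕ q →
  (∀ r s → toℕ p ≤ toℕ r → suc (toℕ r) ≡ toℕ s → toℕ s ≤ toℕ q → f r ∼ f s) →
  f p ∼ f q
adjacent-chain {n} _∼_ ∼-refl ∼-trans f {p} = go (toℕ _) refl
  where
  same : ∀ {q} → toℕ p ≡ toℕ q → f p ∼ f q
  same eq = subst (λ z → f p ∼ f z) (toℕ-injective eq) ∼-refl

  go : ∀ {q} m → toℕ q ≡ m → toℕ p ≤ m →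
    (∀ r s → toℕ p ≤ toℕ r → suc (toℕ r) ≡ toℕ s → toℕ s ≤ toℕ q → f r ∼ f s) → f p ∼ f q
  go zero q≡0 p≤0 _ = same (trans (ℕ.n≤0⇒n≡0 p≤0) (sym q≡0))
  go {q} (suc m) q≡1+m p≤1+m steps with toℕ p ≤? m
  ... | no p≰m = same (trans (ℕ.≤-antisym p≤1+m (ℕ.≰⇒> p≰m)) (sym q≡1+m))
  ... | yes p≤m = ∼-trans (go m toℕ-q′ p≤m (λ r s pr rs sq′ → steps r s pr rs (ℕ.≤-trans sq′ q′≤q)))
                          (steps q′ q (subst (toℕ p ≤_) (sym toℕ-q′) p≤m) (trans (cong suc toℕ-q′) (sym q≡1+m)) ℕ.≤-refl)
    where
    q′ : Fin n
    q′ = fromℕ< (ℕ.<-trans (subst (m <_) (sym q≡1+m) (ℕ.n<1+n m)) (toℕ<n q))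
    toℕ-q′ : toℕ q′ ≡ m
    toℕ-q′ = toℕ-fromℕ< _
    q′≤q : toℕ q′ ≤ toℕ q
    q′≤q = subst₂ _≤_ (sym toℕ-q′) (sym q≡1+m) (ℕ.n≤1+n m)

record Crossing {ℓ} (Q : Pred (Fin n) ℓ) (p q : Fin n) : Set ℓ where
  field
    r s : Fin n
    adjacent : suc (toℕ r) ≡ toℕ s
    p≤r : toℕ p ≤ toℕ r
    s≤q : toℕ s ≤ toℕ q
    holds : Q r
    fails : ¬ Q s

crossing : ∀ {ℓ} {Q : Pred (Fin n) ℓ} {p q} → (∀ m → Dec (Q m)) →
  toℕ p ≤ toℕ q → Q p → ¬ Q q → Crossing Q p q
crossing {Q = Q} {p} {q} Q? p≤q Qp ¬Qq =
  [ (λ Qq → contradiction Qq ¬Qq) , id ]′ (adjacent-chain Persists inj₁ persists-trans Q p≤q persists-step Qp)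
  where
  Persists : Rel _ _
  Persists A B = A → B ⊎ Crossing Q p q
  persists-trans : Transitive Persists
  persists-trans A⇒B B⇒C a = [ B⇒C , inj₂ ]′ (A⇒B a)
  persists-step : ∀ r s → toℕ p ≤ toℕ r → suc (toℕ r) ≡ toℕ s → toℕ s ≤ toℕ q → Persists (Q r) (Q s)
  persists-step r s p≤r rs s≤q Qr with Q? s
  ... | yes Qs = inj₁ Qs
  ... | no ¬Qs = inj₂ (record { r = r ; s = s ; adjacent = rs ; p≤r = p≤r ; s≤q = s≤q ; holds = Qr ; fails = ¬Qs })

module _ (i j : Fin n) where

  transpose-matchˡ : PC.transpose i j i ≡ j
  transpose-matchˡ with i ≟ᶠ i
  ... | yes _ = refl
  ... | no i≢i = contradiction refl i≢i

  transpose-matchʳ : PC.transpose i j j ≡ i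
  transpose-matchʳ with j ≟ᶠ i
  ... | yes j≡i = j≡i
  ... | no _ with j ≟ᶠ j
  ...   | yes _ = refl
  ...   | no j≢j = contradiction refl j≢j

  transpose-other : ∀ {k} → k ≢ i → k ≢ j → PC.transpose i j k ≡ k
  transpose-other {k} k≢i k≢j with k ≟ᶠ i
  ... | yes k≡i = contradiction k≡i k≢i
  ... | no _ with k ≟ᶠ j
  ...   | yes k≡j = contradiction k≡j k≢j
  ...   | no _ = refl

module AdjacentTransposition {r s : Fin n} (adjacent : suc (toℕ r) ≡ toℕ s) where

  T : Fin n → Fin n
  T = PC.transpose r s

  private
    r<s : toℕ r < toℕ s
    r<s = ℕ.≤-reflexive adjacent

    <-distinct : ∀ {a b : Fin n} → toℕ a ≤ toℕ b → a ≢ b → toℕ a < toℕ b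
    <-distinct a≤b a≢b = ℕ.≤∧≢⇒< a≤b (λ eq → a≢b (toℕ-injective eq))

    position : ∀ q → q ≡ r ⊎ q ≡ s ⊎ (q ≢ r × q ≢ s)
    position q with q ≟ᶠ r | q ≟ᶠ s
    ... | yes q≡r | _ = inj₁ q≡r
    ... | no _ | yes q≡s = inj₂ (inj₁ q≡s)
    ... | no q≢r | no q≢s = inj₂ (inj₂ (q≢r , q≢s))

    T-preserves : ∀ y x {y′ x′} → T y ≡ y′ → T x ≡ x′ → toℕ y′ < toℕ x′ → toℕ (T y) < toℕ (T x)
    T-preserves _ _ Ty Tx = subst₂ _<ᶠ_ (sym Ty) (sym Tx)

  transpose-preserves-< : ∀ {y x} → toℕ y < toℕ x → ¬ (y ≡ r × x ≡ s) → toℕ (T y) < toℕ (T x)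
  transpose-preserves-< {y} {x} y<x not-rs with position y | position x
  ... | inj₁ refl | inj₁ refl = contradiction y<x (ℕ.<-irrefl refl)
  ... | inj₁ refl | inj₂ (inj₁ refl) = contradiction (refl , refl) not-rs
  ... | inj₁ refl | inj₂ (inj₂ (x≢r , x≢s)) =
        T-preserves r x (transpose-matchˡ r s) (transpose-other r s x≢r x≢s)
          (<-distinct (subst (_≤ toℕ x) adjacent y<x) (λ s≡x → x≢s (sym s≡x)))
  ... | inj₂ (inj₁ refl) | inj₁ refl = contradiction r<s (ℕ.<-asym y<x)
  ... | inj₂ (inj₁ refl) | inj₂ (inj₁ refl) = contradiction y<x (ℕ.<-irrefl refl)
  ... | inj₂ (inj₁ refl) | inj₂ (inj₂ (x≢r , x≢s)) =
        T-preserves s x (transpose-matchʳ r s) (transpose-other r s x≢r x≢s) (ℕ.<-trans r<s y<x)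
  ... | inj₂ (inj₂ (y≢r , y≢s)) | inj₁ refl =
        T-preserves y r (transpose-other r s y≢r y≢s) (transpose-matchˡ r s) (ℕ.<-trans y<x r<s)
  ... | inj₂ (inj₂ (y≢r , y≢s)) | inj₂ (inj₁ refl) =
        T-preserves y s (transpose-other r s y≢r y≢s) (transpose-matchʳ r s)
          (<-distinct (ℕ.≤-pred (subst (toℕ y <_) (sym adjacent) y<x)) y≢r)
  ... | inj₂ (inj₂ (y≢r , y≢s)) | inj₂ (inj₂ (x≢r , x≢s)) =
        T-preserves y x (transpose-other r s y≢r y≢s) (transpose-other r s x≢r x≢s) y<x

  transpose-reflects-< : ∀ {y x} → toℕ (T y) < toℕ (T x) → toℕ y < toℕ x ⊎ (y ≡ s × x ≡ r)
  transpose-reflects-< {y} {x} Ty<Tx with ℕ.<-cmp (toℕ y) (toℕ x)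
  ... | tri< y<x _ _ = inj₁ y<x
  ... | tri≈ _ y≡x _ = contradiction (cong (toℕ ∘ T) (toℕ-injective y≡x)) (ℕ.<⇒≢ Ty<Tx)
  ... | tri> _ _ x<y with x ≟ᶠ r ×-dec y ≟ᶠ s
  ...   | yes (x≡r , y≡s) = inj₂ (y≡s , x≡r)
  ...   | no not-rs = contradiction (transpose-preserves-< x<y not-rs) (ℕ.<⇒≯ Ty<Tx)

does-true : ∀ {a} {A : Set a} (a? : Dec A) → does a? ≡ true → A
does-true (yes a) _ = a

does-false : ∀ {a} {A : Set a} (a? : Dec A) → does a? ≡ false → ¬ A
does-false (no ¬a) _ = ¬a

indicator : ∀ {a} {A : Set a} → Dec A → ℚ
indicator (yes _) = 1ℚ
indicator (no _) = 0ℚ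

indicator-mono : ∀ {a b} {A : Set a} {B : Set b} (a? : Dec A) (b? : Dec B) →
  (A → B) → indicator a? ≤ℚ indicator b?
indicator-mono (yes _) (yes _) _ = ℚ.≤-refl
indicator-mono (yes x) (no ¬y) A⇒B = contradiction (A⇒B x) ¬y
indicator-mono (no _) (yes _) _ = toWitness {a? = 0ℚ ≤ℚ? 1ℚ} tt
indicator-mono (no _) (no _) _ = ℚ.≤-refl

indicator-reflects : ∀ {a b} {A : Set a} {B : Set b} (a? : Dec A) (b? : Dec B) →
  indicator a? ≤ℚ indicator b? → A → B
indicator-reflects _ (yes y) _ _ = y
indicator-reflects (yes _) (no _) le _ = contradiction le (toWitnessFalse {a? = 1ℚ ≤ℚ? 0ℚ} tt)
indicator-reflects (no ¬x) (no _) _ x = contradiction x ¬x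

indicator-cong : ∀ {a b} {A : Set a} {B : Set b} (a? : Dec A) (b? : Dec B) →
  (A → B) → (B → A) → indicator a? ≡ indicator b?
indicator-cong a? b? A⇒B B⇒A = ℚ.≤-antisym (indicator-mono a? b? A⇒B) (indicator-mono b? a? B⇒A)

entry-injective : (σ : Permutation′ n) → ∀ {p q} → entry σ p ≡ entry σ q → p ≡ q
entry-injective σ = Injection.injective (↔⇒↣ σ)

pos-injective : (σ : Permutation′ n) → ∀ {a b} → pos σ a ≡ pos σ b → a ≡ b
pos-injective σ = Injection.injective (↔⇒↣ (inverse σ))

Sep? : (σ : Permutation′ n) → ∀ u v → Dec (Sep σ u v)
Sep? σ u v = (toℕ u <? toℕ v) ×-dec (toℕ (pos σ v) <? toℕ (pos σ u))

⋖R-intro : ∀ {σ π : Permutation′ n} {u₀ v₀} → σ ≤R π → Sep π u₀ v₀ → ¬ Sep σ u₀ v₀ →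
  (∀ u v → Sep π u v → Sep σ u v ⊎ (u ≡ u₀ × v ≡ v₀)) → σ ⋖R π
⋖R-intro {σ = σ} {π} {u₀} {v₀} σ≤π new ¬old split =
  (σ≤π , λ π≤σ → ¬old (π≤σ u₀ v₀ new)) , nothing-between
  where
  nothing-between : ∀ τ → ¬ (σ <R τ × τ <R π)
  nothing-between τ ((σ≤τ , τ≰σ) , (τ≤π , π≰τ)) with Sep? τ u₀ v₀
  ... | yes τ-new = π≰τ λ u v uv → [ σ≤τ u v , (λ { (refl , refl) → τ-new }) ]′ (split u v uv)
  ... | no ¬τ-new = τ≰σ λ u v uv → [ id , (λ { (refl , refl) → contradiction uv ¬τ-new }) ]′ (split u v (τ≤π u v uv))

module _ (π : Permutation′ n) where

  private
    e : Fin n → Fin n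
    e = entry π

  pos-entry : ∀ p → pos π (e p) ≡ p
  pos-entry p = inverseˡ π

  entry-pos : ∀ a → e (pos π a) ≡ a
  entry-pos a = inverseʳ π

  InRun : Fin n → Fin n → Set
  InRun p q = DescBetween π p q ⊎ DescBetween π q p

  DescBetween-refl : ∀ p → DescBetween π p p
  DescBetween-refl p = ℕ.≤-refl , λ r s p≤r rs s≤p →
    contradiction (ℕ.≤-trans (s≤s p≤r) (subst (_≤ toℕ p) (sym rs) s≤p)) (ℕ.<-irrefl refl)

  DescBetween-shrink : ∀ {p q p′ q′} → toℕ p ≤ toℕ p′ → toℕ q′ ≤ toℕ q → toℕ p′ ≤ toℕ q′ →
    DescBetween π p q → DescBetween π p′ q′
  DescBetween-shrink p≤p′ q′≤q p′≤q′ (_ , desc) =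
    p′≤q′ , λ r s p′≤r rs s≤q′ → desc r s (ℕ.≤-trans p≤p′ p′≤r) rs (ℕ.≤-trans s≤q′ q′≤q)

  DescBetween-trans : ∀ {p q t} → DescBetween π p q → DescBetween π q t → DescBetween π p t
  DescBetween-trans {p} {q} {t} (p≤q , desc₁) (q≤t , desc₂) = ℕ.≤-trans p≤q q≤t , desc
    where
    desc : ∀ r s → toℕ p ≤ toℕ r → suc (toℕ r) ≡ toℕ s → toℕ s ≤ toℕ t → toℕ (e s) < toℕ (e r)
    desc r s p≤r rs s≤t with toℕ r <? toℕ q
    ... | yes r<q = desc₁ r s p≤r rs (subst (_≤ toℕ q) rs r<q)
    ... | no r≮q = desc₂ r s (ℕ.≮⇒≥ r≮q) rs s≤t

  DescBetween-decreasing : ∀ {p q} → DescBetween π p q → toℕ (e q) ≤ toℕ (e p)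
  DescBetween-decreasing (p≤q , desc) =
    adjacent-chain (flip _≤_) ℕ.≤-refl (flip ℕ.≤-trans) (toℕ ∘ e) p≤q
      (λ r s p≤r rs s≤q → ℕ.<⇒≤ (desc r s p≤r rs s≤q))

  private
    InRun-fromCommonStart : ∀ {p q t} → DescBetween π p q → DescBetween π p t → InRun q t
    InRun-fromCommonStart dq@(p≤q , _) dt@(p≤t , _) with ℕ.≤-total (toℕ _) (toℕ _)
    ... | inj₁ q≤t = inj₁ (DescBetween-shrink p≤q ℕ.≤-refl q≤t dt)
    ... | inj₂ t≤q = inj₂ (DescBetween-shrink p≤t ℕ.≤-refl t≤q dq)

    InRun-fromCommonEnd : ∀ {p q t} → DescBetween π p t → DescBetween π q t → InRun p q
    InRun-fromCommonEnd dp dq with ℕ.≤-total (toℕ _) (toℕ _)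
    ... | inj₁ p≤q = inj₁ (DescBetween-shrink ℕ.≤-refl (proj₁ dq) p≤q dp)
    ... | inj₂ q≤p = inj₂ (DescBetween-shrink ℕ.≤-refl (proj₁ dp) q≤p dq)

  InRun-refl : ∀ p → InRun p p
  InRun-refl p = inj₁ (DescBetween-refl p)

  InRun-sym : ∀ {p q} → InRun p q → InRun q p
  InRun-sym = [ inj₂ , inj₁ ]′

  InRun-trans : ∀ {p q t} → InRun p q → InRun q t → InRun p t
  InRun-trans (inj₁ pq) (inj₁ qt) = inj₁ (DescBetween-trans pq qt)
  InRun-trans (inj₁ pq) (inj₂ tq) = InRun-fromCommonEnd pq tq
  InRun-trans (inj₂ qp) (inj₁ qt) = InRun-fromCommonStart qp qt
  InRun-trans (inj₂ qp) (inj₂ tq) = inj₂ (DescBetween-trans tq qp)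

  InRun-convex : ∀ {p q m} → InRun p q → toℕ p ≤ toℕ m → toℕ m ≤ toℕ q → InRun p m
  InRun-convex (inj₁ pq) p≤m m≤q = inj₁ (DescBetween-shrink ℕ.≤-refl m≤q p≤m pq)
  InRun-convex (inj₂ qp@(q≤p , _)) p≤m m≤q =
    inj₂ (DescBetween-shrink (ℕ.≤-trans q≤p p≤m) ℕ.≤-refl (ℕ.≤-trans m≤q q≤p) qp)

  InRun-oriented : ∀ {p q} → InRun p q → toℕ (e q) < toℕ (e p) → DescBetween π p q
  InRun-oriented (inj₁ pq) _ = pq
  InRun-oriented (inj₂ qp) eq<ep = contradiction (DescBetween-decreasing qp) (ℕ.<⇒≱ eq<ep)

  InRun-contiguous : ∀ {p q p′ q′} → ¬ InRun p q → toℕ p < toℕ q →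
    InRun p p′ → InRun q q′ → toℕ p′ < toℕ q′
  InRun-contiguous {p} {q} {p′} {q′} p≁q p<q pp′ qq′ with toℕ q′ ≤? toℕ p′
  ... | no q′≰p′ = ℕ.≰⇒> q′≰p′
  ... | yes q′≤p′ with toℕ q ≤? toℕ p′
  ...   | yes q≤p′ = contradiction (InRun-convex pp′ (ℕ.<⇒≤ p<q) q≤p′) p≁q
  ...   | no q≰p′ = contradiction (InRun-trans pp′ (InRun-sym q≈p′)) p≁q
    where
    q≈p′ : InRun q p′
    q≈p′ = InRun-trans qq′ (InRun-convex (InRun-sym qq′) q′≤p′ (ℕ.<⇒≤ (ℕ.≰⇒> q≰p′)))

  DescBetween? : ∀ p q → Dec (DescBetween π p q)
  DescBetween? p q = (toℕ p ≤? toℕ q) ×-dec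
    all? λ r → all? λ s → (toℕ p ≤? toℕ r) →-dec (suc (toℕ r) ℕ.≟ toℕ s) →-dec
                          (toℕ s ≤? toℕ q) →-dec (toℕ (e s) <? toℕ (e r))

  SameRun? : ∀ a b → Dec (SameRun π a b)
  SameRun? a b = DescBetween? (pos π a) (pos π b) ⊎-dec DescBetween? (pos π b) (pos π a)

  SameRun-entry : ∀ {c p} → InRun (pos π c) p → SameRun π c (e p)
  SameRun-entry {p = p} = subst (InRun _) (sym (pos-entry p))

  ≢-acrossRuns : ∀ {a b c d} → ¬ SameRun π a b → SameRun π a c → SameRun π b d → toℕ c ≢ toℕ d
  ≢-acrossRuns {a} a≁b a≈c b≈d c≡d =
    a≁b (InRun-trans (subst (λ z → InRun (pos π a) (pos π z)) (toℕ-injective c≡d) a≈c) (InRun-sym b≈d))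

  record Straddle (c k : Fin n) : Set where
    field
      r s : Fin n
      adjacent : suc (toℕ r) ≡ toℕ s
      r-inRun : InRun (pos π c) r
      s-inRun : InRun (pos π c) s
      below : toℕ (e s) < toℕ k
      above : toℕ k < toℕ (e r)

  straddle : ∀ {c c′ k} → SameRun π c c′ → toℕ c < toℕ k → toℕ k < toℕ c′ →
    ¬ SameRun π c k → Straddle c k
  straddle {c} {c′} {k} c≈c′ c<k k<c′ c≁k = record
    { r = r ; s = s ; adjacent = adjacent ; r-inRun = r-inRun ; s-inRun = s-inRun
    ; below = ℕ.≤∧≢⇒< (ℕ.≮⇒≥ fails) es≢k ; above = holds }
    where
    run : DescBetween π (pos π c′) (pos π c)
    run = InRun-oriented (InRun-sym c≈c′)
      (subst₂ _<ᶠ_ (sym (entry-pos c)) (sym (entry-pos c′)) (ℕ.<-trans c<k k<c′))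
    open Crossing (crossing (λ m → toℕ k <? toℕ (e m)) (proj₁ run)
                    (subst (λ a → toℕ k < toℕ a) (sym (entry-pos c′)) k<c′)
                    (λ k<c → ℕ.<-asym c<k (subst (λ a → toℕ k < toℕ a) (entry-pos c) k<c)))
    r≤s : toℕ r ≤ toℕ s
    r≤s = ℕ.<⇒≤ (ℕ.≤-reflexive adjacent)
    r-inRun : InRun (pos π c) r
    r-inRun = InRun-trans c≈c′ (InRun-convex (inj₁ run) p≤r (ℕ.≤-trans r≤s s≤q))
    s-inRun : InRun (pos π c) s
    s-inRun = InRun-trans c≈c′ (InRun-convex (inj₁ run) (ℕ.≤-trans p≤r r≤s) s≤q)
    es≢k : toℕ (e s) ≢ toℕ k
    es≢k es≡k = c≁k (subst (InRun (pos π c)) (trans (sym (pos-entry s)) (cong (pos π) (toℕ-injective es≡k))) s-inRun)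

  Descent : Fin n → Fin n → Set
  Descent r s = suc (toℕ r) ≡ toℕ s × toℕ (e s) < toℕ (e r)

  descent-DescBetween : ∀ {r s} → Descent r s → DescBetween π r s
  descent-DescBetween {r} {s} (adjacent , es<er) = ℕ.<⇒≤ (ℕ.≤-reflexive adjacent) , only-step
    where
    only-step : ∀ r′ s′ → toℕ r ≤ toℕ r′ → suc (toℕ r′) ≡ toℕ s′ → toℕ s′ ≤ toℕ s → toℕ (e s′) < toℕ (e r′)
    only-step r′ s′ r≤r′ r′s′ s′≤s = subst₂ (λ a b → toℕ (e b) < toℕ (e a)) (sym r′≡r) (sym s′≡s) es<er
      where
      r′≡r : r′ ≡ r
      r′≡r = toℕ-injective (ℕ.≤-antisym (ℕ.≤-pred (subst₂ _≤_ (sym r′s′) (sym adjacent) s′≤s)) r≤r′)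
      s′≡s : s′ ≡ s
      s′≡s = toℕ-injective (trans (sym r′s′) (trans (cong (suc ∘ toℕ) r′≡r) adjacent))

  descent-SameRun : ∀ {r s} → Descent r s → SameRun π (e s) (e r)
  descent-SameRun {r} {s} descent =
    subst₂ InRun (sym (pos-entry s)) (sym (pos-entry r)) (inj₂ (descent-DescBetween descent))

  -- The signs ε of the shard of the descent at positions r, r + 1 (true standing for +1).
  rightOf : Fin n → Fin n → Bool
  rightOf r k = does (toℕ r <? toℕ (pos π k))

  record InDescentShard (r s : Fin n) (x : Point n) : Set where
    field
      flat : x (e s) ≡ x (e r)
      rightward : ∀ k → toℕ (e s) < toℕ k → toℕ k < toℕ (e r) →
        toℕ r < toℕ (pos π k) → x (e s) ≤ℚ x k
      leftward : ∀ k → toℕ (e s) < toℕ k → toℕ k < toℕ (e r) →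
        toℕ (pos π k) ≤ toℕ r → x k ≤ℚ x (e s)

  InDescentShards : Point n → Set
  InDescentShards x = ∀ r s → Descent r s → InDescentShard r s x

  shard⇒InDescentShard : ∀ {r s x} → Shard (e s) (e r) (rightOf r) x → InDescentShard r s x
  shard⇒InDescentShard {r} (flat , signs) = record
    { flat = flat
    ; rightward = λ k es<k k<er r<k → proj₁ (signs k es<k k<er) (dec-true (toℕ r <? _) r<k)
    ; leftward = λ k es<k k<er k≤r → proj₂ (signs k es<k k<er) (dec-false (toℕ r <? _) (ℕ.≤⇒≯ k≤r))
    }

  InDescentShard⇒shard : ∀ {r s x ε} → InDescentShard r s x →
    (∀ k → toℕ (e s) < toℕ k → toℕ k < toℕ (e r) → ε k ≡ rightOf r k) → Shard (e s) (e r) ε x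
  InDescentShard⇒shard {r} {ε = ε} shard agree = flat , λ k es<k k<er →
    (λ εk → rightward k es<k k<er (does-true (toℕ r <? _) (trans (sym (agree k es<k k<er)) εk))) ,
    (λ εk → leftward k es<k k<er (ℕ.≮⇒≥ (does-false (toℕ r <? _) (trans (sym (agree k es<k k<er)) εk))))
    where open InDescentShard shard

  region-monotone : ∀ {x p q} → Region π x → toℕ p ≤ toℕ q → x (e p) ≤ℚ x (e q)
  region-monotone {x} R p≤q = adjacent-chain _≤ℚ_ ℚ.≤-refl ℚ.≤-trans (x ∘ e) p≤q (λ r s _ rs _ → R r s rs)

  region-InDescentShard : ∀ {r s x} → suc (toℕ r) ≡ toℕ s → Region π x → Hyp (e s) (e r) x →
    InDescentShard r s x
  region-InDescentShard {r} {s} {x} adjacent R H = record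
    { flat = H
    ; rightward = λ k _ _ r<k →
        subst (λ a → x (e s) ≤ℚ x a) (entry-pos k) (region-monotone {x = x} R (subst (_≤ toℕ (pos π k)) adjacent r<k))
    ; leftward = λ k _ _ k≤r → subst₂ _≤ℚ_ (cong x (entry-pos k)) (sym H) (region-monotone {x = x} R k≤r)
    }

  module DescentSwap {r s} (descent : Descent r s) where

    open AdjacentTransposition (proj₁ descent)

    τ : Permutation′ n
    τ = transpose s r ∘ₚ π

    private
      r<s : toℕ r < toℕ s
      r<s = ℕ.≤-reflexive (proj₁ descent)

    inversion : Sep π (e s) (e r)
    inversion = proj₂ descent , subst₂ _<ᶠ_ (sym (pos-entry r)) (sym (pos-entry s)) r<s

    not-inversion : ¬ Sep τ (e s) (e r)
    not-inversion (_ , s<r) = ℕ.<-asym r<s (subst₂ _<ᶠ_ τ-er τ-es s<r)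
      where
      τ-er : pos τ (e r) ≡ s
      τ-er = trans (cong (PC.transpose r s) (pos-entry r)) (transpose-matchˡ r s)
      τ-es : pos τ (e s) ≡ r
      τ-es = trans (cong (PC.transpose r s) (pos-entry s)) (transpose-matchʳ r s)

    Sep-π⇒τ : ∀ u v → Sep π u v → Sep τ u v ⊎ (u ≡ e s × v ≡ e r)
    Sep-π⇒τ u v (u<v , v<u) with pos π v ≟ᶠ r ×-dec pos π u ≟ᶠ s
    ... | yes (v≡r , u≡s) = inj₂ (trans (sym (entry-pos u)) (cong e u≡s) , trans (sym (entry-pos v)) (cong e v≡r))
    ... | no ¬rs = inj₁ (u<v , transpose-preserves-< v<u ¬rs)

    Sep-τ⇒π : ∀ u v → Sep τ u v → Sep π u v
    Sep-τ⇒π u v (u<v , τv<τu) with transpose-reflects-< τv<τu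
    ... | inj₁ v<u = u<v , v<u
    ... | inj₂ (v≡s , u≡r) = contradiction (subst₂ _<ᶠ_
            (trans (sym (entry-pos u)) (cong e u≡r)) (trans (sym (entry-pos v)) (cong e v≡s)) u<v)
            (ℕ.<-asym (proj₂ descent))

    τ⋖π : τ ⋖R π
    τ⋖π = ⋖R-intro {σ = τ} {π = π} Sep-τ⇒π inversion not-inversion Sep-π⇒τ

  descent-isLowerShard : ∀ {r s} → Descent r s → LowerShard π (e s) (e r) (rightOf r)
  descent-isLowerShard descent@(adjacent , es<er) =
    es<er , (τ , τ⋖π , inj₁ (inversion , not-inversion)) ,
    λ x R H → InDescentShard⇒shard (region-InDescentShard adjacent R H) (λ _ _ _ → refl)
    where open DescentSwap descent

  uninverted-descent : ∀ {σ i j} → σ ≤R π → Sep π i j → ¬ Sep σ i j →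
    ∃₂ λ r s → Descent r s × ¬ Sep σ (e s) (e r)
  uninverted-descent {σ} {i} {j} σ≤π (i<j , πj<πi) ¬σij =
    r , s , (adjacent , es<er) , λ (_ , σr<σs) → ℕ.<-asym σs<σr σr<σs
    where
    σ-after-i : Fin n → Set
    σ-after-i m = toℕ (pos σ i) < toℕ (pos σ (e m))
    σi<σj : σ-after-i (pos π j)
    σi<σj = subst (λ a → toℕ (pos σ i) < toℕ (pos σ a)) (sym (entry-pos j))
      (ℕ.≤∧≢⇒< (ℕ.≮⇒≥ (λ σj<σi → ¬σij (i<j , σj<σi)))
        (λ σi≡σj → ℕ.<-irrefl (cong toℕ (pos-injective σ (toℕ-injective σi≡σj))) i<j))
    open Crossing (crossing {Q = σ-after-i} (λ m → toℕ (pos σ i) <? toℕ (pos σ (e m))) (ℕ.<⇒≤ πj<πi) σi<σj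
                    (λ σi<σi → ℕ.<-irrefl (cong (toℕ ∘ pos σ) (sym (entry-pos i))) σi<σi))
    σs<σr : toℕ (pos σ (e s)) < toℕ (pos σ (e r))
    σs<σr = ℕ.≤-<-trans (ℕ.≮⇒≥ fails) holds
    r<s : toℕ r < toℕ s
    r<s = ℕ.≤-reflexive adjacent
    es<er : toℕ (e s) < toℕ (e r)
    es<er with ℕ.<-cmp (toℕ (e s)) (toℕ (e r))
    ... | tri< es<er _ _ = es<er
    ... | tri≈ _ es≡er _ = contradiction (cong toℕ (entry-injective π (toℕ-injective es≡er))) (ℕ.<⇒≢ r<s ∘ sym)
    ... | tri> _ _ er<es = contradiction
            (subst₂ _<ᶠ_ (pos-entry s) (pos-entry r) (proj₂ (σ≤π _ _ (er<es , σs<σr)))) (ℕ.<-asym r<s)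

  cover-differs-only-at : ∀ {σ r s} → σ ⋖R π → Descent r s → ¬ Sep σ (e s) (e r) →
    ∀ u v → Sep π u v → ¬ Sep σ u v → u ≡ e s × v ≡ e r
  cover-differs-only-at {σ} ((σ≤π , _) , nothing-between) descent ¬σsr u v πuv ¬σuv =
    [ (λ τuv → contradiction ((σ≤τ , λ τ≤σ → ¬σuv (τ≤σ u v τuv)) , proj₁ τ⋖π) (nothing-between τ)) , id ]′
      (Sep-π⇒τ u v πuv)
    where
    open DescentSwap descent
    σ≤τ : σ ≤R τ
    σ≤τ u′ v′ σuv = [ id , (λ { (refl , refl) → contradiction σuv ¬σsr }) ]′ (Sep-π⇒τ u′ v′ (σ≤π u′ v′ σuv))

  lowerShard-descent : ∀ {i j ε} → LowerShard π i j ε → ∃₂ λ r s → Descent r s × e s ≡ i × e r ≡ j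
  lowerShard-descent {i} {j} (_ , (σ , σ⋖π@((σ≤π , _) , _) , separates) , _) with separates
  ... | inj₂ (σij , ¬πij) = contradiction (σ≤π i j σij) ¬πij
  ... | inj₁ (πij , ¬σij) with uninverted-descent {σ = σ} σ≤π πij ¬σij
  ...   | r , s , descent , ¬σsr with cover-differs-only-at {σ = σ} σ⋖π descent ¬σsr i j πij ¬σij
  ...     | i≡es , j≡er = r , s , descent , sym i≡es , sym j≡er

  atOrAfter : ℕ → Point n
  atOrAfter c a = indicator (c ≤? toℕ (pos π a))

  private
    ≤-at : ∀ {c} p → c ≤ toℕ p → c ≤ toℕ (pos π (e p))
    ≤-at p = subst (λ a → _ ≤ toℕ a) (sym (pos-entry p))

    at-≤ : ∀ {c} p → c ≤ toℕ (pos π (e p)) → c ≤ toℕ p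
    at-≤ p = subst (λ a → _ ≤ toℕ a) (pos-entry p)

    pos-≢ : ∀ {k p} → toℕ k ≢ toℕ (e p) → toℕ (pos π k) ≢ toℕ p
    pos-≢ {k} {p} k≢ep πk≡p = k≢ep (cong toℕ (trans (sym (entry-pos k)) (cong e (toℕ-injective πk≡p))))

  atOrAfter-region : ∀ c → Region π (atOrAfter c)
  atOrAfter-region c p q pq = indicator-mono (c ≤? _) (c ≤? _) λ c≤p →
    ≤-at q (ℕ.≤-trans (at-≤ p c≤p) (subst (toℕ p ≤_) pq (ℕ.n≤1+n _)))

  -- The 0/1 points atOrAfter r and atOrAfter (s + 1) lie in R_π ∩ H_{π_s π_r}, and at them
  -- the facet condition rules out the sign opposite to rightOf r k.
  lowerShard-signs : ∀ {r s ε} → suc (toℕ r) ≡ toℕ s → LowerShard π (e s) (e r) ε →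
    ∀ k → toℕ (e s) < toℕ k → toℕ k < toℕ (e r) → ε k ≡ rightOf r k
  lowerShard-signs {r} {s} {ε} adjacent (_ , _ , facet) k es<k k<er with ε k in εk
  ... | true = sym (dec-true (toℕ r <? _) (ℕ.≤∧≢⇒< r≤k (pos-≢ (ℕ.<⇒≢ k<er) ∘ sym)))
    where
    r≤s : toℕ r ≤ toℕ s
    r≤s = ℕ.<⇒≤ (ℕ.≤-reflexive adjacent)
    flat : Hyp (e s) (e r) (atOrAfter (toℕ r))
    flat = indicator-cong (_ ≤? _) (_ ≤? _) (λ _ → ≤-at r ℕ.≤-refl) (λ _ → ≤-at s r≤s)
    r≤k : toℕ r ≤ toℕ (pos π k)
    r≤k = indicator-reflects (_ ≤? _) (_ ≤? _)
      (proj₁ (proj₂ (facet (atOrAfter (toℕ r)) (atOrAfter-region (toℕ r)) flat) k es<k k<er) εk) (≤-at s r≤s)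
  ... | false = sym (dec-false (toℕ r <? _) (ℕ.≤⇒≯ k≤r))
    where
    flat : Hyp (e s) (e r) (atOrAfter (suc (toℕ s)))
    flat = indicator-cong (_ ≤? _) (_ ≤? _)
      (λ s<es → contradiction (at-≤ s s<es) (ℕ.<-irrefl refl))
      (λ s<er → contradiction (at-≤ r s<er) (ℕ.<-asym (ℕ.≤-reflexive adjacent)))
    k≤s : toℕ (pos π k) ≤ toℕ s
    k≤s = ℕ.≮⇒≥ λ s<k → ℕ.<-irrefl refl (at-≤ s (indicator-reflects (_ ≤? _) (_ ≤? _)
      (proj₂ (proj₂ (facet (atOrAfter (suc (toℕ s))) (atOrAfter-region (suc (toℕ s))) flat) k es<k k<er) εk) s<k))
    k≤r : toℕ (pos π k) ≤ toℕ r
    k≤r = ℕ.≤-pred (subst (suc (toℕ (pos π k)) ≤_) (sym adjacent) (ℕ.≤∧≢⇒< k≤s (pos-≢ (ℕ.<⇒≢ es<k ∘ sym))))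

  Γ⇒InDescentShards : ∀ {x} → Γ π x → InDescentShards x
  Γ⇒InDescentShards Γx r s descent =
    shard⇒InDescentShard (Γx (e s) (e r) (rightOf r) (descent-isLowerShard descent))

  InDescentShards⇒Γ : ∀ {x} → InDescentShards x → Γ π x
  InDescentShards⇒Γ shards i j ε lower with lowerShard-descent lower
  ... | r , s , descent , refl , refl =
    InDescentShard⇒shard (shards r s descent) (lowerShard-signs (proj₁ descent) lower)

  SameRun-flat : ∀ {x a b} → InDescentShards x → SameRun π a b → x a ≡ x b
  SameRun-flat {x} {a} {b} shards a≈b = begin
    x a             ≡⟨ cong x (entry-pos a) ⟨
    x (e (pos π a)) ≡⟨ InRun-flat a≈b ⟩
    x (e (pos π b)) ≡⟨ cong x (entry-pos b) ⟩
    x b             ∎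
    where
    open ≡-Reasoning
    DescBetween-flat : ∀ {p q} → DescBetween π p q → x (e p) ≡ x (e q)
    DescBetween-flat (p≤q , desc) = adjacent-chain _≡_ refl trans (x ∘ e) p≤q λ r s p≤r rs s≤q →
      sym (InDescentShard.flat (shards r s (rs , desc r s p≤r rs s≤q)))
    InRun-flat : ∀ {p q} → InRun p q → x (e p) ≡ x (e q)
    InRun-flat = [ DescBetween-flat , sym ∘ DescBetween-flat ]′

  OverlapStep : Fin n → Fin n → Set
  OverlapStep a b = ¬ SameRun π a b × RunIntervalsMeet π a b × toℕ (pos π a) < toℕ (pos π b)

  overlap-≤ : ∀ {x a b} → InDescentShards x → OverlapStep a b → x a ≤ℚ x b
  overlap-≤ {x} {a} {b} shards (a≁b , ((d , f , a≈d , b≈f , d≤f) , (d′ , f′ , a≈d′ , b≈f′ , f′≤d′)) , a<b)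
    with toℕ f <? toℕ d′
  ... | yes f<d′ = begin
    x a     ≡⟨ SameRun-flat shards (InRun-trans a≈d (SameRun-entry s-inRun)) ⟩
    x (e s) ≤⟨ InDescentShard.rightward (shards r s (adjacent , ℕ.<-trans below above)) f below above
                 (InRun-contiguous a≁b a<b (InRun-trans a≈d r-inRun) b≈f) ⟩
    x f     ≡⟨ SameRun-flat shards b≈f ⟨
    x b     ∎
    where
    open ℚ.≤-Reasoning
    open Straddle (straddle (InRun-trans (InRun-sym a≈d) a≈d′) (ℕ.≤∧≢⇒< d≤f (≢-acrossRuns a≁b a≈d b≈f)) f<d′
                    λ d≈f → a≁b (InRun-trans (InRun-trans a≈d d≈f) (InRun-sym b≈f)))
  ... | no f≮d′ = begin
    x a     ≡⟨ SameRun-flat shards a≈d′ ⟩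
    x d′    ≤⟨ InDescentShard.leftward (shards r s (adjacent , ℕ.<-trans below above)) d′ below above
                 (ℕ.<⇒≤ (InRun-contiguous a≁b a<b a≈d′ (InRun-trans b≈f′ r-inRun))) ⟩
    x (e s) ≡⟨ SameRun-flat shards (InRun-trans b≈f′ (SameRun-entry s-inRun)) ⟨
    x b     ∎
    where
    open ℚ.≤-Reasoning
    open Straddle (straddle (InRun-trans (InRun-sym b≈f′) b≈f)
                    (ℕ.≤∧≢⇒< f′≤d′ (≢-acrossRuns a≁b a≈d′ b≈f′ ∘ sym))
                    (ℕ.≤∧≢⇒< (ℕ.≮⇒≥ f≮d′) (≢-acrossRuns a≁b a≈d′ b≈f))
                    λ f′≈d′ → a≁b (InRun-trans a≈d′ (InRun-sym (InRun-trans b≈f′ f′≈d′))))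

  μ⇒P : ∀ {a b} → μ π a b → P (Γ π) a b
  μ⇒P a⪯b x Γx = fold (λ u v → x u ≤ℚ x v) step ℚ.≤-refl a⪯b
    where
    shards : InDescentShards x
    shards = Γ⇒InDescentShards Γx
    step : ∀ {u v w} → μStep π u v → x v ≤ℚ x w → x u ≤ℚ x w
    step (inj₁ u≈v) = ℚ.≤-trans (ℚ.≤-reflexive (SameRun-flat shards u≈v))
    step (inj₂ u→v) = ℚ.≤-trans (overlap-≤ shards u→v)

  RunIntervalsMeet? : ∀ a b → Dec (RunIntervalsMeet π a b)
  RunIntervalsMeet? a b =
    (any? λ d → any? λ f → SameRun? a d ×-dec SameRun? b f ×-dec (toℕ d ≤? toℕ f)) ×-dec
    (any? λ d → any? λ f → SameRun? a d ×-dec SameRun? b f ×-dec (toℕ f ≤? toℕ d))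

  OverlapStep? : ∀ a b → Dec (OverlapStep a b)
  OverlapStep? a b = ¬? (SameRun? a b) ×-dec RunIntervalsMeet? a b ×-dec (toℕ (pos π a) <? toℕ (pos π b))

  RunIntervalsMeet-within : ∀ {b c c′ k} → SameRun π b c → SameRun π b c′ →
    toℕ c ≤ toℕ k → toℕ k ≤ toℕ c′ → RunIntervalsMeet π b k × RunIntervalsMeet π k b
  RunIntervalsMeet-within b≈c b≈c′ c≤k k≤c′ =
    ((_ , _ , b≈c , InRun-refl _ , c≤k) , (_ , _ , b≈c′ , InRun-refl _ , k≤c′)) ,
    ((_ , _ , InRun-refl _ , b≈c′ , k≤c′) , (_ , _ , InRun-refl _ , b≈c , c≤k))

  OverlapStep-respects-run : ∀ {a b b′} → OverlapStep a b → SameRun π b b′ → OverlapStep a b′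
  OverlapStep-respects-run (a≁b , ((d , f , a≈d , b≈f , d≤f) , (d′ , f′ , a≈d′ , b≈f′ , f′≤d′)) , a<b) b≈b′ =
    (λ a≈b′ → a≁b (InRun-trans a≈b′ (InRun-sym b≈b′))) ,
    ((d , f , a≈d , InRun-trans (InRun-sym b≈b′) b≈f , d≤f) ,
     (d′ , f′ , a≈d′ , InRun-trans (InRun-sym b≈b′) b≈f′ , f′≤d′)) ,
    InRun-contiguous a≁b a<b (InRun-refl _) b≈b′

  data Reach (i : Fin n) : Fin n → Set where
    same-run : ∀ {m} → SameRun π i m → Reach i m
    overlap-step : ∀ {m m′} → Reach i m → OverlapStep m m′ → Reach i m′

  Reach⇒μ : ∀ {i m} → Reach i m → μ π i m
  Reach⇒μ (same-run i≈m) = return (inj₁ i≈m)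
  Reach⇒μ (overlap-step reach m→m′) = Reach⇒μ reach ◅◅ return (inj₂ m→m′)

  Reach-respects-run : ∀ {i m m′} → Reach i m → SameRun π m m′ → Reach i m′
  Reach-respects-run (same-run i≈m) m≈m′ = same-run (InRun-trans i≈m m≈m′)
  Reach-respects-run (overlap-step reach m″→m) m≈m′ = overlap-step reach (OverlapStep-respects-run m″→m m≈m′)

  Reach-rightward : ∀ {i a b} → Reach i a → RunIntervalsMeet π a b → toℕ (pos π a) < toℕ (pos π b) → Reach i b
  Reach-rightward {a = a} {b} reach meet a<b with SameRun? a b
  ... | yes a≈b = Reach-respects-run reach a≈b
  ... | no a≁b = overlap-step reach (a≁b , meet , a<b)

  Reach? : ∀ i m → Dec (Reach i m)
  Reach? i m = reach-below (suc (toℕ (pos π m))) m ℕ.≤-refl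
    where
    -- Overlap steps move strictly to the right, so recursion on a bound for pos m terminates.
    reach-below : ∀ bound m → toℕ (pos π m) < bound → Dec (Reach i m)
    reach-below (suc bound) m m<bound with SameRun? i m
    ... | yes i≈m = yes (same-run i≈m)
    ... | no i≁m = map′ from-earlier to-earlier (any? earlier?)
      where
      Earlier : Fin n → Set
      Earlier m′ = Reach i m′ × OverlapStep m′ m
      earlier? : ∀ m′ → Dec (Earlier m′)
      earlier? m′ with toℕ (pos π m′) <? toℕ (pos π m)
      ... | yes m′<m = reach-below bound m′ (ℕ.≤-trans m′<m (ℕ.≤-pred m<bound)) ×-dec OverlapStep? m′ m
      ... | no m′≮m = no λ (_ , (_ , _ , m′<m)) → m′≮m m′<m
      from-earlier : ∃ Earlier → Reach i m
      from-earlier (m′ , reach , m′→m) = overlap-step reach m′→m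
      to-earlier : Reach i m → ∃ Earlier
      to-earlier (same-run i≈m) = contradiction i≈m i≁m
      to-earlier (overlap-step {m′} reach m′→m) = m′ , reach , m′→m

  reachIndicator : Fin n → Point n
  reachIndicator i m = indicator (Reach? i m)

  reachIndicator-InDescentShards : ∀ i → InDescentShards (reachIndicator i)
  reachIndicator-InDescentShards i r s descent@(adjacent , _) = record
    { flat = indicator-cong (Reach? i _) (Reach? i _)
        (λ reach → Reach-respects-run reach es≈er) (λ reach → Reach-respects-run reach (InRun-sym es≈er))
    ; rightward = λ k es<k k<er r<k → indicator-mono (Reach? i _) (Reach? i _) λ reach →
        Reach-rightward (Reach-respects-run reach es≈er)
          (proj₁ (RunIntervalsMeet-within (InRun-sym es≈er) (InRun-refl _) (ℕ.<⇒≤ es<k) (ℕ.<⇒≤ k<er)))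
          (subst (λ a → toℕ a < toℕ (pos π k)) (sym (pos-entry r)) r<k)
    ; leftward = λ k es<k k<er k≤r → indicator-mono (Reach? i _) (Reach? i _) λ reach →
        Reach-rightward reach
          (proj₂ (RunIntervalsMeet-within (InRun-refl _) es≈er (ℕ.<⇒≤ es<k) (ℕ.<⇒≤ k<er)))
          (subst (λ a → toℕ (pos π k) < toℕ a) (sym (pos-entry s)) (subst (toℕ (pos π k) <_) adjacent (s≤s k≤r)))
    }
    where
    es≈er : SameRun π (e s) (e r)
    es≈er = descent-SameRun descent

  P⇒μ : ∀ {i j} → P (Γ π) i j → μ π i j
  P⇒μ {i} {j} i⪯j = Reach⇒μ (indicator-reflects (Reach? i i) (Reach? i j)
    (i⪯j (reachIndicator i) (InDescentShards⇒Γ (reachIndicator-InDescentShards i))) (same-run (InRun-refl _)))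

proposition3p3 : (n : ℕ) (π : Permutation′ n) (i j : Fin n) →
    (μ π i j → P (Γ π) i j) × (P (Γ π) i j → μ π i j)
proposition3p3 n π i j = μ⇒P π , P⇒μ π
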